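{- Let $\Pi$ be a finite projective plane and $S=\mathcal{P}_S\cup\mathcal{L}_S$ with $\mathcal{P}_S$ a set of points and $\mathcal{L}_S$ a set of lines. Then $S$ is a resolving set of the incidence graph of $\Pi$ if and only if all of the following hold: (P1) there is at most one line not in $\mathcal{L}_S$ containing no point of $\mathcal{P}_S$; (P1') there is at most one point not in $\mathcal{P}_S$ lying on no line of $\mathcal{L}_S$; (P2) through every point of $\mathcal{P}_S$ there is at most one line not in $\mathcal{L}_S$ containing exactly one point of $\mathcal{P}_S$; (P2') on every line of $\mathcal{L}_S$ there is at most one point not in $\mathcal{P}_S$ lying on exactly one line of $\mathcal{L}_S$.
   Context: The incidence graph of $\Pi$ is the bipartite graph on points and lines with adjacency given by incidence. A set of vertices is resolving if the ordered distance lists of all vertices with respect to it are pairwise distinct. -}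

module Defs where

open import Data.Nat using (ℕ; zero; suc; _<_)
open import Data.Fin using (Fin)
open import Data.Fin.Subset using (Subset; _∈_)
open import Data.Bool using (Bool; true)
open import Data.Sum using (_⊎_; inj₁; inj₂)
open import Data.Product using (Σ; ∃; _×_; _,_)
open import Relation.Binary.PropositionalEquality using (_≡_; _≢_)
open import Relation.Nullary using (¬_)

∃! : {A : Set} → (A → Set) → Set
∃! {A} P = Σ A λ x → P x × (∀ y → P y → y ≡ x)

AtMostOne : {A : Set} → (A → Set) → Set
AtMostOne {A} P = ∀ (x y : A) → P x → P y → x ≡ y

record ProjectivePlane : Set where
  field
    np nl : ℕ
    inc   : Fin np → Fin nl → Bool
  Point = Fin np
  Line  = Fin nl
  I : Point → Line → Set
  I p L = inc p L ≡ true
  field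
    line-through : ∀ (p q : Point) → p ≢ q → ∃! λ L → I p L × I q L
    meet         : ∀ (L M : Line) → L ≢ M → ∃! λ p → I p L × I p M
    quad         : Fin 4 → Point
    quad-inj     : ∀ i j → quad i ≡ quad j → i ≡ j
    quad-gen     : ∀ i j k → i ≢ j → i ≢ k → j ≢ k →
                   ¬ (∃ λ L → I (quad i) L × I (quad j) L × I (quad k) L)

module _ (Π : ProjectivePlane) where
  open ProjectivePlane Π

  Vertex : Set
  Vertex = Point ⊎ Line

  data Adj : Vertex → Vertex → Set where
    pl : ∀ {p L} → I p L → Adj (inj₁ p) (inj₂ L)
    lp : ∀ {p L} → I p L → Adj (inj₂ L) (inj₁ p)

  data Walk : ℕ → Vertex → Vertex → Set where
    here : ∀ {u} → Walk zero u u
    step : ∀ {k u v w} → Adj u v → Walk k v w → Walk (suc k) u w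

  Dist : Vertex → Vertex → ℕ → Set
  Dist u v d = Walk d u v × (∀ k → k < d → ¬ Walk k u v)

  _∈V_ : Vertex → Subset np × Subset nl → Set
  inj₁ p ∈V (PS , LS) = p ∈ PS
  inj₂ L ∈V (PS , LS) = L ∈ LS

  Resolving : Subset np × Subset nl → Set
  Resolving S = ∀ (u v : Vertex) →
    (∀ s → s ∈V S → ∀ d → (Dist u s d → Dist v s d) × (Dist v s d → Dist u s d)) →
    u ≡ v

  module _ (PS : Subset np) (LS : Subset nl) where
    P1 : Set
    P1 = AtMostOne λ L → ¬ (L ∈ LS) × (∀ p → p ∈ PS → ¬ I p L)
    P1' : Set
    P1' = AtMostOne λ p → ¬ (p ∈ PS) × (∀ L → L ∈ LS → ¬ I p L)
    P2 : Set
    P2 = ∀ p → p ∈ PS →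
      AtMostOne λ L → I p L × ¬ (L ∈ LS) × ∃! (λ q → q ∈ PS × I q L)
    P2' : Set
    P2' = ∀ L → L ∈ LS →
      AtMostOne λ p → I p L × ¬ (p ∈ PS) × ∃! (λ M → M ∈ LS × I p M)

module Submission where

open import Defs
open import Data.Product using (_×_; _,_)
open import Data.Fin.Subset using (Subset)

open import Data.Bool using (Bool; true; false)
open import Data.Bool.Properties using (¬-not; ⇔→≡)
open import Data.Empty using (⊥-elim)
open import Data.Fin using (Fin; zero; suc; _≟_)
open import Data.Fin.Subset using (_∈_)
open import Data.Fin.Subset.Properties using (_∈?_)
open import Data.Nat using (ℕ; zero; suc; _<_; s≤s)
open import Data.Nat.Properties using (<-cmp)
open import Data.Product using (Σ; ∃; proj₁; proj₂)
open import Data.Sum using (inj₁; inj₂)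
open import Data.Sum.Properties using (inj₁-injective; inj₂-injective)
open import Function using (_∘_)
open import Function.Bundles using (_⇔_; mk⇔; Equivalence)
open import Relation.Binary.Definitions using (DecidableEquality; tri<; tri≈; tri>)
open import Relation.Binary.PropositionalEquality using (_≡_; _≢_; refl; sym; trans; cong; subst)
open import Relation.Nullary using (¬_; Dec; yes; no; contradiction)

-- In the incidence graph of a projective plane, two points are at distance 0 or 2,
-- two lines likewise, and a point and a line at distance 1 or 3 according to incidence.
-- So the distance vector of a vertex outside S records only its trace (which members of S
-- of the other kind it is incident with), and parity separates points from lines unless S
-- is empty.  Two points outside P_S with the same trace on L_S span a line M: if M is not
-- in L_S, both points miss L_S entirely (excluded by (P1')); if M is in L_S, M is the only
-- line of L_S through either point (excluded by (P2')).  Dually for lines, and conversely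
-- two such points resp. lines are exactly what a resolving set has to separate.

-- Stated for incidence read in either direction, so that it serves points and lines alike.
module Traces {A B : Set} (_≟A_ : DecidableEquality A) (inc : A → B → Bool)
  (common : ∀ a a' → a ≢ a' → ∃! λ b → inc a b ≡ true × inc a' b ≡ true)
  (SA : A → Set) (SB : B → Set) where

  SameTrace : A → A → Set
  SameTrace a a' = ∀ b → SB b → inc a b ≡ inc a' b

  Untouched : A → Set
  Untouched a = ¬ SA a × (∀ b → SB b → ¬ inc a b ≡ true)

  Tangent : B → A → Set
  Tangent b a = inc a b ≡ true × ¬ SA a × ∃! (λ b' → SB b' × inc a b' ≡ true)

  untouched⇒sameTrace : ∀ {a a'} → Untouched a → Untouched a' → SameTrace a a'
  untouched⇒sameTrace (_ , off) (_ , off') b b∈ = trans (¬-not (off b b∈)) (sym (¬-not (off' b b∈)))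

  tangent-unique : ∀ {a b} → SB b → Tangent b a → ∀ {b'} → SB b' → inc a b' ≡ true → b' ≡ b
  tangent-unique b∈ (on , _ , (_ , _ , only)) b'∈ on' = trans (only _ (b'∈ , on')) (sym (only _ (b∈ , on)))

  tangent⇒sameTrace : ∀ {a a' b} → SB b → Tangent b a → Tangent b a' → SameTrace a a'
  tangent⇒sameTrace {a} {a'} b∈ t t' b'' b''∈ = ⇔→≡ (mk⇔ to from)
    where
    to : inc a b'' ≡ true → inc a' b'' ≡ true
    to on = subst (λ x → inc a' x ≡ true) (sym (tangent-unique b∈ t b''∈ on)) (proj₁ t')
    from : inc a' b'' ≡ true → inc a b'' ≡ true
    from on = subst (λ x → inc a x ≡ true) (sym (tangent-unique b∈ t' b''∈ on)) (proj₁ t)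

  sameTrace-sym : ∀ {a a'} → SameTrace a a' → SameTrace a' a
  sameTrace-sym same b b∈ = sym (same b b∈)

  sameTrace-common : ∀ {a a' m} → SameTrace a a' →
                     (∀ b → inc a b ≡ true × inc a' b ≡ true → b ≡ m) →
                     ∀ b → SB b → inc a b ≡ true → b ≡ m
  sameTrace-common same only b b∈ on = only b (on , trans (sym (same b b∈)) on)

  sameTrace⇒≡ : (∀ b → Dec (SB b)) → AtMostOne Untouched → (∀ b → SB b → AtMostOne (Tangent b)) →
                ∀ {a a'} → ¬ SA a → ¬ SA a' → SameTrace a a' → a ≡ a'
  sameTrace⇒≡ SB? untouched-unique tangents-unique {a} {a'} a∉ a'∉ same with a ≟A a'
  ... | yes a≡a' = a≡a'
  ... | no a≢a' with common a a' a≢a'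
  ... | m , (on , on') , only = by-membership (SB? m)
    where
    onlyₗ : ∀ b → SB b → inc a b ≡ true → b ≡ m
    onlyₗ = sameTrace-common same only
    onlyᵣ : ∀ b → SB b → inc a' b ≡ true → b ≡ m
    onlyᵣ = sameTrace-common (sameTrace-sym same) (λ b (x , y) → only b (y , x))
    by-membership : Dec (SB m) → a ≡ a'
    by-membership (no m∉) = untouched-unique a a'
      (a∉  , λ b b∈ on-b → m∉ (subst SB (onlyₗ b b∈ on-b) b∈))
      (a'∉ , λ b b∈ on-b → m∉ (subst SB (onlyᵣ b b∈ on-b) b∈))
    by-membership (yes m∈) = tangents-unique m m∈ a a'
      (on  , a∉  , m , (m∈ , on)  , λ b (b∈ , on-b) → onlyₗ b b∈ on-b)
      (on' , a'∉ , m , (m∈ , on') , λ b (b∈ , on-b) → onlyᵣ b b∈ on-b)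

evenDist : {X : Set} → Dec X → ℕ
evenDist (yes _) = 0
evenDist (no _)  = 2

oddDist : Bool → ℕ
oddDist true  = 1
oddDist false = 3

oddDist-injective : ∀ {x y} → oddDist x ≡ oddDist y → x ≡ y
oddDist-injective {true}  {true}  _ = refl
oddDist-injective {false} {false} _ = refl

oddDist≢evenDist : ∀ {X : Set} (x : Bool) (d : Dec X) → oddDist x ≢ evenDist d
oddDist≢evenDist true  (yes _) ()
oddDist≢evenDist true  (no _)  ()
oddDist≢evenDist false (yes _) ()
oddDist≢evenDist false (no _)  ()

evenDist-≢ : ∀ {n} {x y : Fin n} → x ≢ y → evenDist (x ≟ y) ≡ 2
evenDist-≢ {x = x} {y} x≢y with x ≟ y
... | yes x≡y = contradiction x≡y x≢y
... | no _    = refl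

module _ (Π : ProjectivePlane) where
  open ProjectivePlane Π

  quad₀≢quad-suc : ∀ {i} → quad zero ≢ quad (suc i)
  quad₀≢quad-suc e with quad-inj _ _ e
  ... | ()

  twoDistinctLines : Σ Line λ L → Σ Line λ M → L ≢ M
  twoDistinctLines with line-through (quad zero) (quad (suc zero)) quad₀≢quad-suc
                      | line-through (quad zero) (quad (suc (suc zero))) quad₀≢quad-suc
  ... | L , (on₀ , on₁) , _ | M , (_ , on₂) , _ =
    L , M , λ { refl → quad-gen zero (suc zero) (suc (suc zero)) (λ ()) (λ ()) (λ ()) (L , on₀ , on₁ , on₂) }

  meet-on-first : ∀ {L M} → (∃! λ p → I p L × I p M) → ∃ λ p → I p L
  meet-on-first (p , (on-L , _) , _) = p , on-L

  pointOn : ∀ L → ∃ λ p → I p L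
  pointOn L with twoDistinctLines
  ... | M , M' , M≢M' with L ≟ M
  ... | no L≢M   = meet-on-first (meet L M L≢M)
  ... | yes refl = meet-on-first (meet L M' M≢M')

  adj-sym : ∀ {u v} → Adj Π u v → Adj Π v u
  adj-sym (pl i) = lp i
  adj-sym (lp i) = pl i

  _∷ʳ_ : ∀ {k u v w} → Walk Π k u v → Adj Π v w → Walk Π (suc k) u w
  here       ∷ʳ a = step a here
  step a′ w  ∷ʳ a = step a′ (w ∷ʳ a)

  reverse : ∀ {k u v} → Walk Π k u v → Walk Π k v u
  reverse here       = here
  reverse (step a w) = reverse w ∷ʳ adj-sym a

  dist : Vertex Π → Vertex Π → ℕ
  dist (inj₁ p) (inj₁ q) = evenDist (p ≟ q)
  dist (inj₁ p) (inj₂ L) = oddDist (inc p L)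
  dist (inj₂ L) (inj₁ p) = oddDist (inc p L)
  dist (inj₂ L) (inj₂ M) = evenDist (L ≟ M)

  dist-self : ∀ u → dist u u ≡ 0
  dist-self (inj₁ p) with p ≟ p
  ... | yes _   = refl
  ... | no p≢p  = contradiction refl p≢p
  dist-self (inj₂ L) with L ≟ L
  ... | yes _   = refl
  ... | no L≢L  = contradiction refl L≢L

  dist≡0⇒≡ : ∀ u v → dist u v ≡ 0 → u ≡ v
  dist≡0⇒≡ (inj₁ p) (inj₁ q) d≡0 with p ≟ q
  ... | yes refl = refl
  dist≡0⇒≡ (inj₁ p) (inj₂ L) d≡0 with inc p L
  dist≡0⇒≡ (inj₁ p) (inj₂ L) () | true
  dist≡0⇒≡ (inj₁ p) (inj₂ L) () | false
  dist≡0⇒≡ (inj₂ L) (inj₁ p) d≡0 with inc p L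
  dist≡0⇒≡ (inj₂ L) (inj₁ p) () | true
  dist≡0⇒≡ (inj₂ L) (inj₁ p) () | false
  dist≡0⇒≡ (inj₂ L) (inj₂ M) d≡0 with L ≟ M
  ... | yes refl = refl

  detour : ∀ {p L} → inc p L ≡ false → Walk Π 3 (inj₁ p) (inj₂ L)
  detour {p} {L} off with pointOn L
  ... | q , q-on with p ≟ q
  ... | yes refl = contradiction (trans (sym q-on) off) λ ()
  ... | no p≢q with line-through p q p≢q
  ... | M , (p-on , q-on′) , _ = step (pl p-on) (step (lp q-on′) (step (pl q-on) here))

  walk-dist : ∀ u v → Walk Π (dist u v) u v
  walk-dist (inj₁ p) (inj₁ q) with p ≟ q
  ... | yes refl = here
  ... | no p≢q with line-through p q p≢q
  ... | L , (p-on , q-on) , _ = step (pl p-on) (step (lp q-on) here)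
  walk-dist (inj₁ p) (inj₂ L) with inc p L in eq
  ... | true  = step (pl eq) here
  ... | false = detour eq
  walk-dist (inj₂ L) (inj₁ p) = reverse (walk-dist (inj₁ p) (inj₂ L))
  walk-dist (inj₂ L) (inj₂ M) with L ≟ M
  ... | yes refl = here
  ... | no L≢M with meet L M L≢M
  ... | p , (on-L , on-M) , _ = step (lp on-L) (step (pl on-M) here)

  shorter-walk-absurd : ∀ u v k → k < dist u v → ¬ Walk Π k u v
  shorter-walk-absurd (inj₁ p) (inj₁ q) k k<d w with p ≟ q
  shorter-walk-absurd (inj₁ p) (inj₁ q) k () w | yes _
  shorter-walk-absurd (inj₁ p) (inj₁ p) zero _ here | no p≢p = p≢p refl
  shorter-walk-absurd (inj₁ p) (inj₁ q) (suc zero) _ (step (pl _) ()) | no _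
  shorter-walk-absurd (inj₁ p) (inj₁ q) (suc (suc k)) (s≤s (s≤s ())) w | no _
  shorter-walk-absurd (inj₁ p) (inj₂ L) k k<d w with inc p L in eq
  shorter-walk-absurd (inj₁ p) (inj₂ L) zero _ () | _
  shorter-walk-absurd (inj₁ p) (inj₂ L) (suc k) (s≤s ()) w | true
  shorter-walk-absurd (inj₁ p) (inj₂ L) (suc zero) _ (step (pl on) here) | false =
    contradiction (trans (sym on) eq) λ ()
  shorter-walk-absurd (inj₁ p) (inj₂ L) (suc (suc zero)) _ (step (pl _) (step (lp _) ())) | false
  shorter-walk-absurd (inj₁ p) (inj₂ L) (suc (suc (suc k))) (s≤s (s≤s (s≤s ()))) w | false
  shorter-walk-absurd (inj₂ L) (inj₁ p) k k<d w = shorter-walk-absurd (inj₁ p) (inj₂ L) k k<d (reverse w)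
  shorter-walk-absurd (inj₂ L) (inj₂ M) k k<d w with L ≟ M
  shorter-walk-absurd (inj₂ L) (inj₂ M) k () w | yes _
  shorter-walk-absurd (inj₂ L) (inj₂ L) zero _ here | no L≢L = L≢L refl
  shorter-walk-absurd (inj₂ L) (inj₂ M) (suc zero) _ (step (lp _) ()) | no _
  shorter-walk-absurd (inj₂ L) (inj₂ M) (suc (suc k)) (s≤s (s≤s ())) w | no _

  Dist-dist : ∀ u v → Dist Π u v (dist u v)
  Dist-dist u v = walk-dist u v , shorter-walk-absurd u v

  Dist⇒≡dist : ∀ {u v d} → Dist Π u v d → d ≡ dist u v
  Dist⇒≡dist {u} {v} {d} (w , minimal) with <-cmp d (dist u v)
  ... | tri< d<dist _ _ = contradiction w (shorter-walk-absurd u v d d<dist)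
  ... | tri≈ _ d≡dist _ = d≡dist
  ... | tri> _ _ dist<d = contradiction (walk-dist u v) (minimal (dist u v) dist<d)

  module _ (PS : Subset np) (LS : Subset nl) where

    InS : Vertex Π → Set
    InS s = _∈V_ Π s (PS , LS)

    InS? : ∀ u → Dec (InS u)
    InS? (inj₁ p) = p ∈? PS
    InS? (inj₂ L) = L ∈? LS

    SameDistances : Vertex Π → Vertex Π → Set
    SameDistances u v = ∀ s → InS s → dist u s ≡ dist v s

    sameDistances-sym : ∀ {u v} → SameDistances u v → SameDistances v u
    sameDistances-sym same s s∈ = sym (same s s∈)

    transport-Dist : ∀ {u v} → SameDistances u v → ∀ s → InS s → ∀ d → Dist Π u s d → Dist Π v s d
    transport-Dist {u} {v} same s s∈ d D =
      subst (Dist Π v s) (sym (trans (Dist⇒≡dist D) (same s s∈))) (Dist-dist v s)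

    DistanceResolving : Set
    DistanceResolving = ∀ u v → SameDistances u v → u ≡ v

    Resolving⇔ : Resolving Π (PS , LS) ⇔ DistanceResolving
    Resolving⇔ = mk⇔
      (λ R u v same → R u v λ s s∈ d →
        transport-Dist {u} {v} same s s∈ d , transport-Dist (sameDistances-sym {u} {v} same) s s∈ d)
      (λ R u v agree → R u v λ s s∈ →
        Dist⇒≡dist (proj₁ (agree s s∈ (dist u s)) (Dist-dist u s)))

    member-resolved : ∀ {u v} → InS u → SameDistances u v → u ≡ v
    member-resolved {u} {v} u∈ same = sym (dist≡0⇒≡ v u (trans (sym (same u u∈)) (dist-self u)))

    module PointTraces = Traces _≟_ inc line-through (_∈ PS) (_∈ LS)
    module LineTraces  = Traces _≟_ (λ L p → inc p L) meet (_∈ LS) (_∈ PS)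

    sameTrace⇒sameDistancesᵖ : ∀ {p q} → ¬ p ∈ PS → ¬ q ∈ PS →
                               PointTraces.SameTrace p q → SameDistances (inj₁ p) (inj₁ q)
    sameTrace⇒sameDistancesᵖ p∉ q∉ same (inj₁ r) r∈ =
      trans (evenDist-≢ λ { refl → p∉ r∈ }) (sym (evenDist-≢ λ { refl → q∉ r∈ }))
    sameTrace⇒sameDistancesᵖ p∉ q∉ same (inj₂ M) M∈ = cong oddDist (same M M∈)

    sameTrace⇒sameDistancesˡ : ∀ {L M} → ¬ L ∈ LS → ¬ M ∈ LS →
                               LineTraces.SameTrace L M → SameDistances (inj₂ L) (inj₂ M)
    sameTrace⇒sameDistancesˡ L∉ M∉ same (inj₁ r) r∈ = cong oddDist (same r r∈)
    sameTrace⇒sameDistancesˡ L∉ M∉ same (inj₂ N) N∈ =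
      trans (evenDist-≢ λ { refl → L∉ N∈ }) (sym (evenDist-≢ λ { refl → M∉ N∈ }))

    sameDistances⇒sameTraceᵖ : ∀ {p q} → SameDistances (inj₁ p) (inj₁ q) → PointTraces.SameTrace p q
    sameDistances⇒sameTraceᵖ same M M∈ = oddDist-injective (same (inj₂ M) M∈)

    sameDistances⇒sameTraceˡ : ∀ {L M} → SameDistances (inj₂ L) (inj₂ M) → LineTraces.SameTrace L M
    sameDistances⇒sameTraceˡ same r r∈ = oddDist-injective (same (inj₁ r) r∈)

    Conditions : Set
    Conditions = P1 Π PS LS × P1' Π PS LS × P2 Π PS LS × P2' Π PS LS

    points-resolved : DistanceResolving → ∀ {p q} → ¬ p ∈ PS → ¬ q ∈ PS →
                      PointTraces.SameTrace p q → p ≡ q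
    points-resolved R p∉ q∉ same = inj₁-injective (R _ _ (sameTrace⇒sameDistancesᵖ p∉ q∉ same))

    lines-resolved : DistanceResolving → ∀ {L M} → ¬ L ∈ LS → ¬ M ∈ LS →
                     LineTraces.SameTrace L M → L ≡ M
    lines-resolved R L∉ M∉ same = inj₂-injective (R _ _ (sameTrace⇒sameDistancesˡ L∉ M∉ same))

    distanceResolving⇒conditions : DistanceResolving → Conditions
    distanceResolving⇒conditions R =
      (λ L M u u′ → lines-resolved R (proj₁ u) (proj₁ u′) (LineTraces.untouched⇒sameTrace u u′)) ,
      (λ p q u u′ → points-resolved R (proj₁ u) (proj₁ u′) (PointTraces.untouched⇒sameTrace u u′)) ,
      (λ p p∈ L M t t′ → lines-resolved R (proj₁ (proj₂ t)) (proj₁ (proj₂ t′))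
                           (LineTraces.tangent⇒sameTrace p∈ t t′)) ,
      (λ L L∈ p q t t′ → points-resolved R (proj₁ (proj₂ t)) (proj₁ (proj₂ t′))
                           (PointTraces.tangent⇒sameTrace L∈ t t′))

    -- By parity, such p and L force P_S and L_S to be empty, and then every line violates (P1).
    point-line-resolved : P1 Π PS LS → ∀ {p L} → ¬ SameDistances (inj₁ p) (inj₂ L)
    point-line-resolved P1-holds {p} {L} same with twoDistinctLines
    ... | M , M′ , M≢M′ = M≢M′ (P1-holds M M′ (untouched M) (untouched M′))
      where
      untouched : ∀ N → LineTraces.Untouched N
      untouched N = (λ N∈ → oddDist≢evenDist (inc p N) (L ≟ N) (same (inj₂ N) N∈))
                  , (λ q q∈ _ → oddDist≢evenDist (inc q L) (p ≟ q) (sym (same (inj₁ q) q∈)))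

    outside-resolved : Conditions → ∀ u v → ¬ InS u → ¬ InS v → SameDistances u v → u ≡ v
    outside-resolved (_ , P1'-holds , _ , P2'-holds) (inj₁ p) (inj₁ q) p∉ q∉ same =
      cong inj₁ (PointTraces.sameTrace⇒≡ (_∈? LS) P1'-holds P2'-holds p∉ q∉ (sameDistances⇒sameTraceᵖ same))
    outside-resolved (P1-holds , _ , P2-holds , _) (inj₂ L) (inj₂ M) L∉ M∉ same =
      cong inj₂ (LineTraces.sameTrace⇒≡ (_∈? PS) P1-holds P2-holds L∉ M∉ (sameDistances⇒sameTraceˡ same))
    outside-resolved (P1-holds , _) (inj₁ p) (inj₂ L) _ _ same =
      ⊥-elim (point-line-resolved P1-holds same)
    outside-resolved (P1-holds , _) (inj₂ L) (inj₁ p) _ _ same =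
      ⊥-elim (point-line-resolved P1-holds (sameDistances-sym {inj₂ L} {inj₁ p} same))

    conditions⇒distanceResolving : Conditions → DistanceResolving
    conditions⇒distanceResolving conds u v same with InS? u | InS? v
    ... | yes u∈ | _      = member-resolved u∈ same
    ... | no _   | yes v∈ = sym (member-resolved v∈ (sameDistances-sym {u} {v} same))
    ... | no u∉  | no v∉  = outside-resolved conds u v u∉ v∉ same

proposition2p1 : (Π : ProjectivePlane) →
    (PS : Subset (ProjectivePlane.np Π)) → (LS : Subset (ProjectivePlane.nl Π)) →
    (Resolving Π (PS , LS) → P1 Π PS LS × P1' Π PS LS × P2 Π PS LS × P2' Π PS LS) ×
    (P1 Π PS LS × P1' Π PS LS × P2 Π PS LS × P2' Π PS LS → Resolving Π (PS , LS))
proposition2p1 Π PS LS =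
  distanceResolving⇒conditions Π PS LS ∘ Equivalence.to (Resolving⇔ Π PS LS) ,
  Equivalence.from (Resolving⇔ Π PS LS) ∘ conditions⇒distanceResolving Π PS LS
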